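{- Let $G_1,\dots,G_q$ be $3$-graphs. For each $i\in[q]$, let $(H_i,F_i)$ be an arbitrary pair to which $G_i$ is reducible, and if no such pair exists, let $H_i=G_i$. Let $h=\max_{i\in[q]} v(H_i)$. Then \[ r(G_1,\dots,G_q) \le r(H_1,\dots,H_q)^h \cdot q \cdot \max\Big( \{1\}\cup\{ r(G_1,\dots,G_{i-1},F_i,G_{i+1},\dots,G_q) : i\in[q],\ G_i \text{ is reducible}\}\Big). \]
   Context: For $3$-graphs $G_1,\dots,G_q$, the Ramsey number $r(G_1,\dots,G_q)$ is the minimum positive integer $N$ such that in every coloring of the edges of the complete $3$-graph $K_N^{(3)}$ with colors $1,\dots,q$ there is some $i$ for which there is a copy of $G_i$ all of whose edges have color $i$. $v(G)$ denotes the number of vertices of $G$. For a $3$-graph $G$, a set $U\subseteq V(G)$ with $2\le |U|<|V(G)|$ is collapsible if no edge of $G$ intersects $U$ in exactly two vertices. Given such $U$, let $v^*$ be a new vertex and let $H$ be the $3$-graph with vertex set $(V(G)\setminus U)\cup\{v^*\}$ and edge set $\{e\in E(G): e\cap U=\emptyset\}\cup\{xyv^*: \exists u\in U,\ xyu\in E(G)\}$. Then $G$ is said to be reducible to the pair $(H, G[U])$. $G$ is reducible if it is reducible to some pair. -}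

module Defs where

open import Data.Nat using (ℕ; zero; suc; _≤_; _<_; _⊔_)
open import Data.Fin using (Fin; zero; suc; _≟_)
open import Data.Fin.Subset using (Subset; _∈_; _∉_; ∣_∣)
open import Data.Maybe using (Maybe; just; nothing)
open import Data.Product using (Σ; ∃; ∃-syntax; _×_; _,_)
open import Data.Empty using (⊥)
open import Data.Sum using (_⊎_)
open import Function using (_∘_; _⇔_)
open import Function.Definitions using (Injective)
open import Relation.Binary.PropositionalEquality using (_≡_; _≢_)
open import Relation.Nullary using (¬_; yes; no)
open import Level using (0ℓ)

-- A 3-graph on vertex set Fin n.  E x y z means {x,y,z} is an edge;
-- E is invariant under permutations and only holds for distinct x,y,z.
record Graph3 : Set₁ where
  field
    n        : ℕ
    E        : Fin n → Fin n → Fin n → Set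
    E-swap₁  : ∀ {x y z} → E x y z → E y x z
    E-swap₂  : ∀ {x y z} → E x y z → E x z y
    E-dist   : ∀ {x y z} → E x y z → (x ≢ y) × (y ≢ z) × (x ≢ z)
open Graph3 public

v : Graph3 → ℕ
v G = n G

-- A q-colouring of the edges of K_N^(3): a colour for every (unordered) triple,
-- given as a function on ordered triples invariant under permutations.
SymColouring : (N q : ℕ) → (Fin N → Fin N → Fin N → Fin q) → Set
SymColouring N q c = (∀ x y z → c x y z ≡ c y x z) × (∀ x y z → c x y z ≡ c x z y)

MonoCopy : ∀ {N q} → (Fin N → Fin N → Fin N → Fin q) → Fin q → Graph3 → Set
MonoCopy {N} c i G =
  Σ (Fin (n G) → Fin N) λ f →
    Injective _≡_ _≡_ f × (∀ x y z → E G x y z → c (f x) (f y) (f z) ≡ i)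

Arrows : (q N : ℕ) → (Fin q → Graph3) → Set
Arrows q N Gs = ∀ (c : Fin N → Fin N → Fin N → Fin q) → SymColouring N q c →
  ∃[ i ] MonoCopy c i (Gs i)

IsRamsey : (q r : ℕ) → (Fin q → Graph3) → Set
IsRamsey q r Gs = (1 ≤ r) × Arrows q r Gs × (∀ m → 1 ≤ m → m < r → ¬ Arrows q m Gs)

Collapsible : (G : Graph3) → Subset (n G) → Set
Collapsible G U = (2 ≤ ∣ U ∣) × (∣ U ∣ < n G) ×
  (∀ x y z → E G x y z → x ∈ U → y ∈ U → z ∉ U → ⊥)

-- Edges of the collapsed graph on vertex set (V(G) \ U) ∪ {v*},
-- with v* represented by nothing and a vertex x ∉ U by just x.
CollapsedEdge : (G : Graph3) → Subset (n G) →
  Maybe (Fin (n G)) → Maybe (Fin (n G)) → Maybe (Fin (n G)) → Set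
CollapsedEdge G U (just x) (just y) (just z) = E G x y z
CollapsedEdge G U (just x) (just y) nothing  = ∃[ u ] (u ∈ U × E G x y u)
CollapsedEdge G U (just x) nothing  (just y) = ∃[ u ] (u ∈ U × E G x y u)
CollapsedEdge G U nothing  (just x) (just y) = ∃[ u ] (u ∈ U × E G x y u)
CollapsedEdge G U _ _ _ = ⊥

IsoCollapse : (G : Graph3) → Subset (n G) → Graph3 → Set
IsoCollapse G U H =
  Σ (Fin (n H) → Maybe (Fin (n G))) λ φ →
    Injective _≡_ _≡_ φ ×
    (∀ a x → φ a ≡ just x → x ∉ U) ×
    (∃[ a ] φ a ≡ nothing) ×
    (∀ x → x ∉ U → ∃[ a ] φ a ≡ just x) ×
    (∀ a b c → E H a b c ⇔ CollapsedEdge G U (φ a) (φ b) (φ c))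

IsoInduced : (G : Graph3) → Subset (n G) → Graph3 → Set
IsoInduced G U F =
  Σ (Fin (n F) → Fin (n G)) λ ψ →
    Injective _≡_ _≡_ ψ ×
    (∀ a → ψ a ∈ U) ×
    (∀ x → x ∈ U → ∃[ a ] ψ a ≡ x) ×
    (∀ a b c → E F a b c ⇔ E G (ψ a) (ψ b) (ψ c))

ReducibleTo : Graph3 → Graph3 → Graph3 → Set
ReducibleTo G H F = ∃[ U ] (Collapsible G U × IsoCollapse G U H × IsoInduced G U F)

Reducible : Graph3 → Set₁
Reducible G = Σ Graph3 λ H → Σ Graph3 λ F → ReducibleTo G H F

replace : ∀ {q} → (Fin q → Graph3) → Fin q → Graph3 → Fin q → Graph3
replace Gs i F j with j ≟ i
... | yes _ = F
... | no  _ = Gs j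

maxFin : ∀ {q} → (Fin q → ℕ) → ℕ
maxFin {zero}  f = 0
maxFin {suc q} f = f zero ⊔ maxFin (f ∘ suc)

-- Write R = r(H₁,…,H_q), h = max v(Hᵢ) and N = R^h·q·M. For an injective R-tuple t of vertices of
-- K_N, the Ramsey property of the Hᵢ yields a monochromatic copy of some Hᵢ inside t; record it by
-- its colour and its map into the R positions (at most q·R^h possibilities), and single out the
-- position of the collapsed vertex v* when Gᵢ is reducible. There are at least N − R + 1 times as
-- many injective R-tuples as injective (R−1)-tuples, so, as R ≤ R^h·q, pigeonhole gives M tuples
-- with the same record which agree off the distinguished position. The M vertices found there
-- span a K_M ⊇ K_{r(G₁,…,Fᵢ,…,G_q)}: either it contains a copy of some G_j (j ≠ i) in colour j, or
-- a copy of Fᵢ in colour i, and then substituting that copy for v* in the common copy of Hᵢ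
-- gives a copy of Gᵢ in colour i, since no edge of Gᵢ meets U in exactly two vertices. When Gᵢ
-- is not reducible, Hᵢ = Gᵢ and a single tuple suffices.

module Submission where

open import Defs

open import Data.Empty using (⊥; ⊥-elim)
open import Data.Fin using (Fin; zero; suc; _≟_; inject≤; punchOut; funToFin; finToFun)
open import Data.Fin.Properties using (¬Fin0; inject≤-injective; punchIn-punchOut; finToFun-funToFin)
open import Data.Fin.Subset using () renaming (_∈_ to _∈ₛ_; _∉_ to _∉ₛ_)
open import Data.Fin.Subset.Properties using () renaming (_∈?_ to _∈ₛ?_)
open import Data.List using (List; []; _∷_; [_]; _++_; length; filter; map; concatMap; lookup; allFin)
open import Data.List.Properties using (length-++; length-map; length-tabulate)
open import Data.List.Membership.Propositional using (_∈_; find; lose)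
open import Data.List.Membership.Propositional.Properties
  using (∈-filter⁻; ∈-filter⁺; ∈-lookup; ∈-map⁺; ∈-map⁻; ∈-concatMap⁺; ∈-concatMap⁻; ∈-allFin)
open import Data.List.Relation.Binary.Disjoint.Propositional using (Disjoint)
open import Data.List.Relation.Binary.Sublist.Propositional.Properties using (filter-⊆; filter⁺; length-mono-≤)
open import Data.List.Relation.Unary.All as All using (All; []; _∷_)
open import Data.List.Relation.Unary.All.Properties using (all-filter)
open import Data.List.Relation.Unary.AllPairs as AllPairs using ()
import Data.List.Relation.Unary.AllPairs.Properties as AllPairs
open import Data.List.Relation.Unary.Any using (here; there)
open import Data.List.Relation.Unary.Unique.Propositional using (Unique; []; _∷_)
import Data.List.Relation.Unary.Unique.Propositional.Properties as Unique
open import Data.Maybe.Properties using (just-injective)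
open import Data.Nat using (ℕ; zero; suc; _+_; _*_; _∸_; _^_; _≤_; _<_; z≤n; s≤s; NonZero; >-nonZero)
open import Data.Nat.Properties hiding (_≟_)
open import Data.Product using (Σ; ∃-syntax; _×_; _,_; proj₁; proj₂)
import Data.Product.Properties as Product
open import Data.Sum using (_⊎_; inj₁; inj₂)
open import Data.Vec as Vec using (Vec; []; _∷_; toList)
open import Data.Vec.Properties
  using (length-toList; ∷-injectiveˡ; ∷-injectiveʳ; insertAt-removeAt; insertAt-lookup; insertAt-punchIn)
  renaming (≡-dec to ≡-decᵥ)
import Data.Vec.Membership.DecPropositional as VecMembership
open import Data.Vec.Membership.Propositional using () renaming (_∉_ to _∉ᵥ_)
open import Data.Vec.Membership.Propositional.Properties using (∈-toList⁺)
import Data.Vec.Relation.Unary.All as VecAll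
open import Data.Vec.Relation.Unary.AllPairs using ([]; _∷_)
open import Data.Vec.Relation.Unary.Any using (here; there)
open import Data.Vec.Relation.Unary.Unique.Propositional using () renaming (Unique to Distinct)
open import Data.Vec.Relation.Unary.Unique.Propositional.Properties
  using () renaming (lookup-injective to Distinct-lookup-injective)
open import Function using (_∘_; id)
open import Function.Bundles using (Equivalence)
open import Function.Definitions using (Injective)
open import Relation.Binary.Definitions using (DecidableEquality)
open import Relation.Binary.PropositionalEquality using (_≡_; _≢_; refl; sym; trans; cong; cong₂; subst)
open import Relation.Nullary using (¬_; Dec; yes; no; ¬?; contradiction)
open import Relation.Unary using (Pred; Decidable)
open import Relation.Unary.Properties using (∁?)

module _ {a p} {A : Set a} {P : Pred A p} (P? : Decidable P) where

  length-filter-∁ : ∀ xs → length xs ≡ length (filter P? xs) + length (filter (∁? P?) xs)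
  length-filter-∁ []       = refl
  length-filter-∁ (x ∷ xs) with P? x
  ... | yes _ = cong suc (length-filter-∁ xs)
  ... | no  _ = trans (cong suc (length-filter-∁ xs)) (sym (+-suc _ _))

module _ {a b} {A : Set a} {B : Set b} (_≟_ : DecidableEquality B) (f : A → B) where

  pigeonhole : ∀ {m} ys xs → All (λ x → f x ∈ ys) xs → length ys * m < length xs →
               ∃[ y ] m < length (filter (λ x → f x ≟ y) xs)
  pigeonhole []       []       _        ()
  pigeonhole []       (x ∷ xs) (() ∷ _) _
  pigeonhole {m} (y ∷ ys) xs fxs∈ ys*m<xs with m <? length (filter (λ x → f x ≟ y) xs)
  ... | yes many = y , many
  ... | no  few  with pigeonhole ys others (others∈ys xs fxs∈) ys*m<others
    where
    others = filter (∁? (λ x → f x ≟ y)) xs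

    others∈ys : ∀ zs → All (λ x → f x ∈ y ∷ ys) zs →
                All (λ x → f x ∈ ys) (filter (∁? (λ x → f x ≟ y)) zs)
    others∈ys []       []           = []
    others∈ys (z ∷ zs) (fz∈ ∷ fzs∈) with f z ≟ y | fz∈
    ... | yes _    | _           = others∈ys zs fzs∈
    ... | no  fz≢y | here fz≡y   = contradiction fz≡y fz≢y
    ... | no  _    | there fz∈ys = fz∈ys ∷ others∈ys zs fzs∈

    ys*m<others : length ys * m < length others
    ys*m<others = +-cancelˡ-< m _ _ (begin-strict
      m + length ys * m                                   <⟨ ys*m<xs ⟩
      length xs                                           ≡⟨ length-filter-∁ (λ x → f x ≟ y) xs ⟩
      length (filter (λ x → f x ≟ y) xs) + length others  ≤⟨ +-monoˡ-≤ _ (≮⇒≥ few) ⟩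
      m + length others                                   ∎)
      where open ≤-Reasoning
  ... | z , many = z , ≤-trans many (length-mono-≤ (filter⁺ _ _ (λ { refl fx≡z → fx≡z }) (filter-⊆ _ xs)))

module _ {a} {A : Set a} where

  Unique-const⇒length≤1 : ∀ {y} {xs : List A} → Unique xs → All (_≡ y) xs → length xs ≤ 1
  Unique-const⇒length≤1 {xs = []}        _               _               = z≤n
  Unique-const⇒length≤1 {xs = _ ∷ []}    _               _               = s≤s z≤n
  Unique-const⇒length≤1 {xs = _ ∷ _ ∷ _} ((x≢z ∷ _) ∷ _) (x≡y ∷ z≡y ∷ _) =
    contradiction (trans x≡y (sym z≡y)) x≢z

  Unique-lookup-injective : ∀ {xs : List A} → Unique xs → ∀ i j → lookup xs i ≡ lookup xs j → i ≡ j
  Unique-lookup-injective {_ ∷ _} _         zero    zero    _  = refl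
  Unique-lookup-injective {_ ∷ _} (x∉ ∷ _)  zero    (suc j) x≡ =
    contradiction x≡ (All.lookup x∉ (∈-lookup j))
  Unique-lookup-injective {_ ∷ _} (x∉ ∷ _)  (suc i) zero    ≡x =
    contradiction (sym ≡x) (All.lookup x∉ (∈-lookup i))
  Unique-lookup-injective {_ ∷ _} (_ ∷ xs!) (suc i) (suc j) eq = cong suc (Unique-lookup-injective xs! i j eq)

module _ {a} {A : Set a} (_≟_ : DecidableEquality A) where

  Unique-⊆⇒length-≤ : ∀ {xs} ys → Unique xs → (∀ {x} → x ∈ xs → x ∈ ys) → length xs ≤ length ys
  Unique-⊆⇒length-≤ {[]}     []       _   _     = z≤n
  Unique-⊆⇒length-≤ {x ∷ xs} []       _   xs⊆[] with () ← xs⊆[] (here refl)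
  Unique-⊆⇒length-≤ {xs}     (y ∷ ys) xs! xs⊆ = begin
    length xs                                                   ≡⟨ length-filter-∁ (_≟ y) xs ⟩
    length (filter (_≟ y) xs) + length (filter (∁? (_≟ y)) xs)
      ≤⟨ +-mono-≤ (Unique-const⇒length≤1 (Unique.filter⁺ (_≟ y) xs!) (all-filter (_≟ y) xs))
                  (Unique-⊆⇒length-≤ ys (Unique.filter⁺ (∁? (_≟ y)) xs!) rest⊆ys) ⟩
    suc (length ys)                                             ∎
    where
    open ≤-Reasoning
    rest⊆ys : ∀ {x} → x ∈ filter (∁? (_≟ y)) xs → x ∈ ys
    rest⊆ys x∈ with ∈-filter⁻ (∁? (_≟ y)) x∈
    ... | x∈xs , x≢y with xs⊆ x∈xs
    ...   | here x≡y   = contradiction x≡y x≢y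
    ...   | there x∈ys = x∈ys

module _ {a b} {A : Set a} {B : Set b} (g : A → List B) (c : ℕ) where

  length-concatMap-≤ : (∀ x → length (g x) ≤ c) → ∀ xs → length (concatMap g xs) ≤ length xs * c
  length-concatMap-≤ g≤c []       = z≤n
  length-concatMap-≤ g≤c (x ∷ xs) = begin
    length (g x ++ concatMap g xs)           ≡⟨ length-++ (g x) ⟩
    length (g x) + length (concatMap g xs)   ≤⟨ +-mono-≤ (g≤c x) (length-concatMap-≤ g≤c xs) ⟩
    c + length xs * c                        ∎
    where open ≤-Reasoning

  length-concatMap-≥ : ∀ xs → (∀ {x} → x ∈ xs → c ≤ length (g x)) →
                       length xs * c ≤ length (concatMap g xs)
  length-concatMap-≥ []       _   = z≤n
  length-concatMap-≥ (x ∷ xs) c≤g = begin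
    c + length xs * c
      ≤⟨ +-mono-≤ (c≤g (here refl)) (length-concatMap-≥ xs (c≤g ∘ there)) ⟩
    length (g x) + length (concatMap g xs)   ≡⟨ length-++ (g x) ⟨
    length (g x ++ concatMap g xs)           ∎
    where open ≤-Reasoning

-- Injective tuples

∉⇒All≢ : ∀ {a} {A : Set a} {k} {x : A} {t : Vec A k} → x ∉ᵥ t → VecAll.All (x ≢_) t
∉⇒All≢ {t = []}    _  = VecAll.[]
∉⇒All≢ {t = _ ∷ _} x∉ = (x∉ ∘ here) VecAll.∷ ∉⇒All≢ (x∉ ∘ there)

All-removeAt : ∀ {a p} {A : Set a} {P : A → Set p} {k} {xs : Vec A (suc k)} →
               VecAll.All P xs → ∀ i → VecAll.All P (Vec.removeAt xs i)
All-removeAt (_ VecAll.∷ pxs) zero = pxs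
All-removeAt {xs = _ ∷ _ ∷ _} (px VecAll.∷ pxs) (suc i) = px VecAll.∷ All-removeAt pxs i

Distinct-removeAt : ∀ {a} {A : Set a} {k} {t : Vec A (suc k)} → Distinct t → ∀ i → Distinct (Vec.removeAt t i)
Distinct-removeAt (_ ∷ t!) zero = t!
Distinct-removeAt {t = _ ∷ _ ∷ _} (x≢ ∷ t!) (suc i) = All-removeAt x≢ i ∷ Distinct-removeAt t! i

lookup-insertAt-≢ : ∀ {a} {A : Set a} {k} (xs : Vec A k) {i j : Fin (suc k)} (i≢j : i ≢ j) x →
                    Vec.lookup (Vec.insertAt xs i x) j ≡ Vec.lookup xs (punchOut i≢j)
lookup-insertAt-≢ xs {i} i≢j x =
  trans (cong (Vec.lookup (Vec.insertAt xs i x)) (sym (punchIn-punchOut i≢j))) (insertAt-punchIn xs i x (punchOut i≢j))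

module InjectiveTuples (N : ℕ) where

  open VecMembership (_≟_ {N}) using (_∈?_)

  _∉?_ : ∀ {k} x (t : Vec (Fin N) k) → Dec (x ∉ᵥ t)
  x ∉? t = ¬? (x ∈? t)

  fresh : ∀ {k} → Vec (Fin N) k → List (Fin N)
  fresh t = filter (_∉? t) (allFin N)

  extensions : ∀ {k} → Vec (Fin N) k → List (Vec (Fin N) (suc k))
  extensions t = map (_∷ t) (fresh t)

  injectiveTuples : ∀ k → List (Vec (Fin N) k)
  injectiveTuples zero    = [ [] ]
  injectiveTuples (suc k) = concatMap extensions (injectiveTuples k)

  ∈-injectiveTuples⁻ : ∀ {k t} → t ∈ injectiveTuples k → Distinct t
  ∈-injectiveTuples⁻ {zero}  (here refl) = []
  ∈-injectiveTuples⁻ {suc k} t∈ with find (∈-concatMap⁻ extensions {xs = injectiveTuples k} t∈)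
  ... | u , u∈ , t∈ext with ∈-map⁻ (_∷ u) t∈ext
  ...   | x , x∈ , refl =
    ∉⇒All≢ (proj₂ (∈-filter⁻ (_∉? u) {xs = allFin N} x∈)) ∷ ∈-injectiveTuples⁻ u∈

  ∈-injectiveTuples⁺ : ∀ {k} {t : Vec (Fin N) k} → Distinct t → t ∈ injectiveTuples k
  ∈-injectiveTuples⁺ {t = []}    []        = here refl
  ∈-injectiveTuples⁺ {t = x ∷ t} (x≢ ∷ t!) = ∈-concatMap⁺ extensions (lose (∈-injectiveTuples⁺ t!)
    (∈-map⁺ (_∷ t) (∈-filter⁺ (_∉? t) (∈-allFin x) (λ x∈ → VecAll.lookup x≢ x∈ refl))))

  injectiveTuples-unique : ∀ k → Unique (injectiveTuples k)
  injectiveTuples-unique zero    = [] ∷ []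
  injectiveTuples-unique (suc k) =
    Unique.concat⁺ (extensions-unique (injectiveTuples k))
                   (AllPairs.map⁺ (AllPairs.map extensions-disjoint (injectiveTuples-unique k)))
    where
    extensions-unique : ∀ ts → All Unique (map extensions ts)
    extensions-unique []       = []
    extensions-unique (t ∷ ts) =
      Unique.map⁺ ∷-injectiveˡ (Unique.filter⁺ (_∉? t) (Unique.allFin⁺ N)) ∷ extensions-unique ts
    extensions-disjoint : ∀ {t u : Vec (Fin N) k} → t ≢ u → Disjoint (extensions t) (extensions u)
    extensions-disjoint t≢u (∈t , ∈u) with ∈-map⁻ _ ∈t | ∈-map⁻ _ ∈u
    ... | _ , _ , refl | _ , _ , eq = t≢u (∷-injectiveʳ eq)

  length-fresh : ∀ {k} (t : Vec (Fin N) k) → N ∸ k ≤ length (fresh t)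
  length-fresh {k} t = begin
    N ∸ k                                          ≤⟨ ∸-monoʳ-≤ N used≤k ⟩
    N ∸ length used                                ≡⟨ cong (_∸ length used) split ⟩
    length used + length (fresh t) ∸ length used   ≡⟨ m+n∸m≡n (length used) _ ⟩
    length (fresh t)                               ∎
    where
    open ≤-Reasoning
    used = filter (_∈? t) (allFin N)
    split : N ≡ length used + length (fresh t)
    split = trans (sym (length-tabulate id)) (length-filter-∁ (_∈? t) (allFin N))
    used≤k : length used ≤ k
    used≤k = ≤-trans (Unique-⊆⇒length-≤ _≟_ (toList t) (Unique.filter⁺ (_∈? t) (Unique.allFin⁺ N))
                                          (λ x∈ → ∈-toList⁺ (proj₂ (∈-filter⁻ (_∈? t) {xs = allFin N} x∈))))
                     (≤-reflexive (length-toList t))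

  length-injectiveTuples-suc : ∀ k → length (injectiveTuples k) * (N ∸ k) ≤ length (injectiveTuples (suc k))
  length-injectiveTuples-suc k = length-concatMap-≥ extensions (N ∸ k) (injectiveTuples k)
    (λ {t} _ → ≤-trans (length-fresh t) (≤-reflexive (sym (length-map (_∷ t) (fresh t)))))

  injectiveTuples-nonempty : ∀ {k} → k ≤ N → 0 < length (injectiveTuples k)
  injectiveTuples-nonempty {zero}  _   = s≤s z≤n
  injectiveTuples-nonempty {suc k} k<N = ≤-trans
    (*-mono-≤ (injectiveTuples-nonempty (<⇒≤ k<N)) (m<n⇒0<n∸m k<N)) (length-injectiveTuples-suc k)

-- Sunflowers of injective tuples

module _ {ℓ} {K : Set ℓ} (_≟ᴷ_ : DecidableEquality K) {N k : ℕ}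
         (label : Vec (Fin N) (suc k) → K) (centre : K → Fin (suc k)) where

  record Sunflower (m : ℕ) : Set ℓ where
    field
      kind            : K
      core            : Vec (Fin N) k
      petal           : Fin (suc m) → Fin N
      petal-injective : Injective _≡_ _≡_ petal
      tuple-distinct  : ∀ j → Distinct (Vec.insertAt core (centre kind) (petal j))
      tuple-label     : ∀ j → label (Vec.insertAt core (centre kind) (petal j)) ≡ kind

  open InjectiveTuples N

  private
    Key = K × Vec (Fin N) k

    key : Vec (Fin N) (suc k) → Key
    key t = label t , Vec.removeAt t (centre (label t))

    _≟-key_ : DecidableEquality Key
    _≟-key_ = Product.≡-dec _≟ᴷ_ (≡-decᵥ _≟_)

    reassemble : ∀ {κ d} t → key t ≡ (κ , d) → t ≡ Vec.insertAt d (centre κ) (Vec.lookup t (centre κ))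
    reassemble t refl = sym (insertAt-removeAt t (centre (label t)))

    keys : List K → List Key
    keys labels = concatMap (λ κ → map (κ ,_) (injectiveTuples k)) labels

    key∈keys : ∀ {labels} → (∀ t → label t ∈ labels) →
               All (λ t → key t ∈ keys labels) (injectiveTuples (suc k))
    key∈keys label∈ = All.tabulate λ t∈ → ∈-concatMap⁺ _ (lose (label∈ _)
      (∈-map⁺ _ (∈-injectiveTuples⁺ (Distinct-removeAt (∈-injectiveTuples⁻ t∈) _))))

    few-keys : ∀ {m} labels → length labels * m < N ∸ k →
               length (keys labels) * m < length (injectiveTuples (suc k))
    few-keys {m} labels few-labels = begin-strict
      length (keys labels) * m  ≤⟨ *-monoˡ-≤ m (length-concatMap-≤ _ D length-labelled labels) ⟩
      L * D * m                 ≡⟨ *-assoc L D m ⟩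
      L * (D * m)               ≡⟨ cong (L *_) (*-comm D m) ⟩
      L * (m * D)               ≡⟨ *-assoc L m D ⟨
      L * m * D                 <⟨ *-monoˡ-< D few-labels ⟩
      (N ∸ k) * D               ≡⟨ *-comm (N ∸ k) D ⟩
      D * (N ∸ k)               ≤⟨ length-injectiveTuples-suc k ⟩
      length (injectiveTuples (suc k)) ∎
      where
      open ≤-Reasoning
      L = length labels
      D = length (injectiveTuples k)
      length-labelled : ∀ κ → length (map (κ ,_) (injectiveTuples k)) ≤ D
      length-labelled κ = ≤-reflexive (length-map (κ ,_) (injectiveTuples k))
      instance
        D≢0 : NonZero D
        D≢0 = >-nonZero (injectiveTuples-nonempty {k} (<⇒≤ (m∸n≢0⇒n<m (n>0⇒n≢0 (m<n⇒0<n few-labels)))))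

  sunflower : ∀ {m} (labels : List K) → (∀ t → label t ∈ labels) → length labels * m < N ∸ k → Sunflower m
  sunflower {m} labels label∈ few-labels
    with pigeonhole _≟-key_ key (keys labels) _ (key∈keys label∈) (few-keys labels few-labels)
  ... | (κ , d) , many = record
    { kind            = κ
    ; core            = d
    ; petal           = petal
    ; petal-injective = petal-injective
    ; tuple-distinct  = λ j → subst Distinct (reassembled j) (∈-injectiveTuples⁻ (proj₁ (∈S j)))
    ; tuple-label     = λ j → trans (cong label (sym (reassembled j))) (cong proj₁ (proj₂ (∈S j)))
    }
    where
    S = filter (λ t → key t ≟-key (κ , d)) (injectiveTuples (suc k))
    tuple : Fin (suc m) → Vec (Fin N) (suc k)
    tuple j = lookup S (inject≤ j many)
    ∈S : ∀ j → tuple j ∈ injectiveTuples (suc k) × key (tuple j) ≡ (κ , d)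
    ∈S j = ∈-filter⁻ _ (∈-lookup (inject≤ j many))
    petal : Fin (suc m) → Fin N
    petal j = Vec.lookup (tuple j) (centre κ)
    reassembled : ∀ j → tuple j ≡ Vec.insertAt d (centre κ) (petal j)
    reassembled j = reassemble (tuple j) (proj₂ (∈S j))
    petal-injective : Injective _≡_ _≡_ petal
    petal-injective {j} {j′} eq = inject≤-injective many many j j′
      (Unique-lookup-injective (Unique.filter⁺ _ (injectiveTuples-unique (suc k))) _ _
        (trans (reassembled j) (trans (cong (Vec.insertAt d (centre κ)) eq) (sym (reassembled j′)))))

Colouring : ℕ → ℕ → Set
Colouring N q = Fin N → Fin N → Fin N → Fin q

restrict : ∀ {K N q} → Colouring N q → (Fin K → Fin N) → Colouring K q
restrict c σ x y z = c (σ x) (σ y) (σ z)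

restrict-symmetric : ∀ {K N q} {c : Colouring N q} (σ : Fin K → Fin N) →
                     SymColouring N q c → SymColouring K q (restrict c σ)
restrict-symmetric σ (swap₁ , swap₂) =
  (λ x y z → swap₁ (σ x) (σ y) (σ z)) , (λ x y z → swap₂ (σ x) (σ y) (σ z))

IsMonoCopy : ∀ {N q} → Colouring N q → Fin q → (G : Graph3) → (Fin (n G) → Fin N) → Set
IsMonoCopy c i G f = Injective _≡_ _≡_ f × (∀ x y z → E G x y z → c (f x) (f y) (f z) ≡ i)

module _ {N q} {c : Colouring N q} {i : Fin q} {G : Graph3} where

  IsMonoCopy-resp-≗ : ∀ {f g} → (∀ x → f x ≡ g x) → IsMonoCopy c i G f → IsMonoCopy c i G g
  IsMonoCopy-resp-≗ {f} {g} f≗g (f-inj , f-edge) = g-inj , g-edge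
    where
    g-inj : Injective _≡_ _≡_ g
    g-inj {x} {y} gx≡gy = f-inj (trans (f≗g x) (trans gx≡gy (sym (f≗g y))))
    g-edge : ∀ x y z → E G x y z → c (g x) (g y) (g z) ≡ i
    g-edge x y z e rewrite sym (f≗g x) | sym (f≗g y) | sym (f≗g z) = f-edge x y z e

  IsMonoCopy-lift : ∀ {K} {σ : Fin K → Fin N} {f} → Injective _≡_ _≡_ σ →
                    IsMonoCopy (restrict c σ) i G f → IsMonoCopy c i G (σ ∘ f)
  IsMonoCopy-lift σ-inj (f-inj , f-edge) = f-inj ∘ σ-inj , f-edge

  MonoCopy-lift : ∀ {K} {σ : Fin K → Fin N} → Injective _≡_ _≡_ σ →
                  MonoCopy (restrict c σ) i G → MonoCopy c i G
  MonoCopy-lift σ-inj (_ , copy) = _ , IsMonoCopy-lift σ-inj copy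

≤-maxFin : ∀ {q} (f : Fin q → ℕ) i → f i ≤ maxFin f
≤-maxFin f zero    = m≤m⊔n _ _
≤-maxFin f (suc i) = ≤-trans (≤-maxFin (f ∘ suc) i) (m≤n⊔m (f zero) _)

ramsey-minimal : ∀ {q r N} {Gs : Fin q → Graph3} → IsRamsey q r Gs → 1 ≤ N → Arrows q N Gs → r ≤ N
ramsey-minimal {r = r} {N} (_ , _ , below-r-fails) 1≤N arrows with r ≤? N
... | yes r≤N = r≤N
... | no  r≰N = contradiction arrows (below-r-fails N 1≤N (≰⇒> r≰N))

arrows-empty : ∀ {q} (Hs : Fin (suc q) → Graph3) → (∀ i → v (Hs i) ≤ 0) → Arrows (suc q) 1 Hs
arrows-empty Hs empty _ _ =
  zero , (λ a → ⊥-elim (no-vertex a)) , (λ {a} → ⊥-elim (no-vertex a)) , (λ a → ⊥-elim (no-vertex a))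
  where
  no-vertex : Fin (v (Hs zero)) → ⊥
  no-vertex a = ¬Fin0 (subst Fin (n≤0⇒n≡0 (empty zero)) a)

ramsey-≤-power : ∀ {q r} {Hs : Fin (suc q) → Graph3} h → (∀ i → v (Hs i) ≤ h) →
                 IsRamsey (suc q) r Hs → r ≤ r ^ h * suc q
ramsey-≤-power {Hs = Hs}    zero    empty ramsey =
  ≤-trans (ramsey-minimal {Gs = Hs} ramsey ≤-refl (arrows-empty Hs empty)) (s≤s z≤n)
ramsey-≤-power {r = zero}   (suc h) _     (() , _)
ramsey-≤-power {q} {suc r′} (suc h) _     _      = ≤-trans (m≤m*n (suc r′) (suc r′ ^ h)) (m≤m*n _ (suc q))
  where instance _ = m^n≢0 (suc r′) h

replace-at : ∀ {q} (Gs : Fin q → Graph3) i X → replace Gs i X i ≡ X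
replace-at Gs i X with i ≟ i
... | yes _   = refl
... | no  i≢i = contradiction refl i≢i

replace-off : ∀ {q} (Gs : Fin q → Graph3) {i j} X → j ≢ i → replace Gs i X j ≡ Gs j
replace-off Gs {i} {j} X j≢i with j ≟ i
... | yes j≡i = contradiction j≡i j≢i
... | no  _   = refl

arrows-replace : ∀ {q K} {Gs : Fin q → Graph3} {i X} → Arrows q K (replace Gs i X) →
                 (c : Colouring K q) → SymColouring K q c → MonoCopy c i X ⊎ ∃[ j ] MonoCopy c j (Gs j)
arrows-replace {Gs = Gs} {i} {X} arrows c c-sym with j , copy ← arrows c c-sym = sort (j ≟ i) copy
  where
  sort : ∀ {j} → Dec (j ≡ i) → MonoCopy c j (replace Gs i X j) → MonoCopy c i X ⊎ ∃[ j ] MonoCopy c j (Gs j)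
  sort {j} (yes refl) copy = inj₁ (subst (MonoCopy c i) (replace-at Gs i X) copy)
  sort {j} (no  j≢i)  copy = inj₂ (j , subst (MonoCopy c j) (replace-off Gs X j≢i) copy)

-- Gluing a copy of F into copies of H

collapsedVertex : ∀ {G H F} → ReducibleTo G H F → Fin (n H)
collapsedVertex (_ , _ , (_ , _ , _ , (a , _) , _) , _) = a

glue : ∀ {N q} {c : Colouring N q} {i : Fin q} {G H F : Graph3} → SymColouring N q c →
       (red : ReducibleTo G H F) → ∀ {m} (copy : Fin (suc m) → Fin (n H) → Fin N) →
       (∀ j → IsMonoCopy c i H (copy j)) →
       (∀ j j′ {b} → b ≢ collapsedVertex {G} {H} {F} red → copy j b ≡ copy j′ b) →
       let tip : Fin (suc m) → Fin N
           tip j = copy j (collapsedVertex {G} {H} {F} red) in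
       Injective _≡_ _≡_ tip → MonoCopy (restrict c tip) i F → MonoCopy c i G
glue {N} {c = c} {i} {G} {H} {F} (swap₁ , swap₂)
     (U , (_ , _ , no-two) , (φ , _ , _ , (a* , φa*≡nothing) , φ-onto , φ-edge) , (ψ , _ , _ , ψ-onto , ψ-edge))
     copy copies agree tip-inj (ε , ε-inj , ε-edge) =
  (λ x → embed x (x ∈ₛ? U)) ,
  (λ {x} {y} → embed-injective x y (x ∈ₛ? U) (y ∈ₛ? U)) ,
  (λ x y z → embed-edge x y z (x ∈ₛ? U) (y ∈ₛ? U) (z ∈ₛ? U))
  where
  tip = λ j → copy j a*

  outer : ∀ x → x ∉ₛ U → Fin (n H)
  outer x x∉ = proj₁ (φ-onto x x∉)

  inner : ∀ x → x ∈ₛ U → Fin (n F)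
  inner x x∈ = proj₁ (ψ-onto x x∈)

  outer≢a* : ∀ x x∉ → outer x x∉ ≢ a*
  outer≢a* x x∉ refl with () ← trans (sym (proj₂ (φ-onto x x∉))) φa*≡nothing

  -- Outside U follow the copies of H (they agree there); on U follow the copy of F among the tips.
  embed : ∀ x → Dec (x ∈ₛ U) → Fin N
  embed x (yes x∈) = tip (ε (inner x x∈))
  embed x (no  x∉) = copy zero (outer x x∉)

  tip≢outer : ∀ j y y∉ → tip j ≢ copy zero (outer y y∉)
  tip≢outer j y y∉ eq = outer≢a* y y∉ (sym (proj₁ (copies j) (trans eq (agree zero j (outer≢a* y y∉)))))

  embed-injective : ∀ x y dx dy → embed x dx ≡ embed y dy → x ≡ y
  embed-injective x y (yes x∈) (yes y∈) eq =
    trans (sym (proj₂ (ψ-onto x x∈))) (trans (cong ψ (ε-inj (tip-inj eq))) (proj₂ (ψ-onto y y∈)))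
  embed-injective x y (no x∉) (no y∉) eq = just-injective
    (trans (sym (proj₂ (φ-onto x x∉))) (trans (cong φ (proj₁ (copies zero) eq)) (proj₂ (φ-onto y y∉))))
  embed-injective x y (yes x∈) (no y∉) eq = contradiction eq (tip≢outer _ y y∉)
  embed-injective x y (no x∉) (yes y∈) eq = contradiction (sym eq) (tip≢outer _ x x∉)

  from-collapsed : ∀ {a b d a′ b′ d′} → φ a ≡ a′ → φ b ≡ b′ → φ d ≡ d′ →
                   CollapsedEdge G U a′ b′ d′ → E H a b d
  from-collapsed refl refl refl = Equivalence.from (φ-edge _ _ _)

  from-induced : ∀ {a b d x y z} → ψ a ≡ x → ψ b ≡ y → ψ d ≡ z → E G x y z → E F a b d
  from-induced refl refl refl = Equivalence.from (ψ-edge _ _ _)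

  -- In H this edge passes through a*, so it has colour i in the copy whose tip is the image of z.
  crossing-edge : ∀ x y z x∉ y∉ z∈ → E G x y z →
                  c (embed x (no x∉)) (embed y (no y∉)) (embed z (yes z∈)) ≡ i
  crossing-edge x y z x∉ y∉ z∈ e =
    trans (cong₂ (λ u w → c u w (tip j)) (agree zero j (outer≢a* x x∉)) (agree zero j (outer≢a* y y∉)))
          (proj₂ (copies j) _ _ _
            (from-collapsed (proj₂ (φ-onto x x∉)) (proj₂ (φ-onto y y∉)) φa*≡nothing (z , z∈ , e)))
    where j = ε (inner z z∈)

  embed-edge : ∀ x y z dx dy dz → E G x y z → c (embed x dx) (embed y dy) (embed z dz) ≡ i
  embed-edge x y z (no x∉) (no y∉) (no z∉) e = proj₂ (copies zero) _ _ _
    (from-collapsed (proj₂ (φ-onto x x∉)) (proj₂ (φ-onto y y∉)) (proj₂ (φ-onto z z∉)) e)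
  embed-edge x y z (no x∉) (no y∉) (yes z∈) e = crossing-edge x y z x∉ y∉ z∈ e
  embed-edge x y z (no x∉) (yes y∈) (no z∉) e =
    trans (swap₂ _ _ _) (crossing-edge x z y x∉ z∉ y∈ (E-swap₂ G e))
  embed-edge x y z (yes x∈) (no y∉) (no z∉) e =
    trans (swap₁ _ _ _) (trans (swap₂ _ _ _) (crossing-edge y z x y∉ z∉ x∈ (E-swap₂ G (E-swap₁ G e))))
  embed-edge x y z (yes x∈) (yes y∈) (no z∉) e = ⊥-elim (no-two x y z e x∈ y∈ z∉)
  embed-edge x y z (yes x∈) (no y∉) (yes z∈) e = ⊥-elim (no-two x z y (E-swap₂ G e) x∈ z∈ y∉)
  embed-edge x y z (no x∉) (yes y∈) (yes z∈) e = ⊥-elim (no-two y z x (E-swap₂ G (E-swap₁ G e)) y∈ z∈ x∉)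
  embed-edge x y z (yes x∈) (yes y∈) (yes z∈) e =
    ε-edge _ _ _ (from-induced (proj₂ (ψ-onto x x∈)) (proj₂ (ψ-onto y y∈)) (proj₂ (ψ-onto z z∈)) e)

module Reduction {q} (G H F : Fin q → Graph3)
  (reduction : ∀ i → ReducibleTo (G i) (H i) (F i) ⊎ (¬ Reducible (G i) × H i ≡ G i))
  {R′} (H-arrows : Arrows q (suc R′) H)
  (rF : Fin q → ℕ) (F-ramsey : ∀ i → Reducible (G i) → IsRamsey q (rF i) (replace G i (F i)))
  {m} (rF≤M : ∀ i → Reducible (G i) → rF i ≤ suc m)
  where

  R = suc R′
  h = maxFin (λ i → v (H i))

  ReductionOrSelf : Fin q → Set₁
  ReductionOrSelf i = ReducibleTo (G i) (H i) (F i) ⊎ (¬ Reducible (G i) × H i ≡ G i)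

  Label : Set
  Label = Σ (Fin q) λ i → Fin (R ^ v (H i))

  _≟-label_ : DecidableEquality Label
  _≟-label_ = Product.≡-dec _≟_ _≟_

  labelsOf : Fin q → List Label
  labelsOf i = map (i ,_) (allFin (R ^ v (H i)))

  labels : List Label
  labels = concatMap labelsOf (allFin q)

  ∈-labels : ∀ κ → κ ∈ labels
  ∈-labels (i , w) = ∈-concatMap⁺ _ (lose (∈-allFin i) (∈-map⁺ (i ,_) (∈-allFin w)))

  length-labels : length labels ≤ R ^ h * q
  length-labels = begin
    length labels              ≤⟨ length-concatMap-≤ labelsOf (R ^ h) length-labelsOf (allFin q) ⟩
    length (allFin q) * R ^ h  ≡⟨ cong (_* R ^ h) (length-tabulate {n = q} id) ⟩
    q * R ^ h                  ≡⟨ *-comm q (R ^ h) ⟩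
    R ^ h * q                  ∎
    where
    open ≤-Reasoning
    length-labelsOf : ∀ i → length (labelsOf i) ≤ R ^ h
    length-labelsOf i = begin
      length (labelsOf i)            ≡⟨ length-map {B = Label} (i ,_) (allFin (R ^ v (H i))) ⟩
      length (allFin (R ^ v (H i)))  ≡⟨ length-tabulate {n = R ^ v (H i)} id ⟩
      R ^ v (H i)                    ≤⟨ ^-monoʳ-≤ R (≤-maxFin (λ i → v (H i)) i) ⟩
      R ^ h                          ∎

  -- The position of the collapsed vertex; an arbitrary one (zero) when G i is not reducible.
  centreOf : ∀ {i} → ReductionOrSelf i → (Fin (n (H i)) → Fin R) → Fin R
  centreOf {i} (inj₁ red) f = f (collapsedVertex {G i} {H i} {F i} red)
  centreOf     (inj₂ _)   _ = zero

  centre : Label → Fin R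
  centre (i , w) = centreOf (reduction i) (finToFun w)

  labelOf : (c : Colouring R q) → ∃[ i ] MonoCopy c i (H i) → Label
  labelOf _ (i , f , _) = i , funToFin f

  labelOf-copy : (c : Colouring R q) (found : ∃[ i ] MonoCopy c i (H i)) → ∀ {i w} →
                 labelOf c found ≡ (i , w) → IsMonoCopy c i (H i) (finToFun w)
  labelOf-copy c (i , f , copy) refl = IsMonoCopy-resp-≗ {c = c} {i} {H i} (λ a → sym (finToFun-funToFin f a)) copy

  module _ {N} (c : Colouring N q) (c-sym : SymColouring N q c) where

    found : (t : Vec (Fin N) R) → ∃[ i ] MonoCopy (restrict c (Vec.lookup t)) i (H i)
    found t = H-arrows (restrict c (Vec.lookup t)) (restrict-symmetric (Vec.lookup t) c-sym)

    label : Vec (Fin N) R → Label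
    label t = labelOf (restrict c (Vec.lookup t)) (found t)

    from-petals : ∀ {i} (r : ReductionOrSelf i) {f : Fin (n (H i)) → Fin R}
                  {core : Vec (Fin N) R′} {petal : Fin (suc m) → Fin N} → Injective _≡_ _≡_ petal →
                  (∀ j → IsMonoCopy c i (H i) (Vec.lookup (Vec.insertAt core (centreOf r f) (petal j)) ∘ f)) →
                  ∃[ j ] MonoCopy c j (G j)
    from-petals {i} (inj₂ (_ , H≡G)) _ copies = i , subst (MonoCopy c i) H≡G (_ , copies zero)
    from-petals {i} (inj₁ red) {f} {core} {petal} petal-inj copies =
      conclude (arrows-replace (proj₁ (proj₂ (F-ramsey i reducible)))
                               (restrict c (tip ∘ ι)) (restrict-symmetric _ c-sym))
      where
      reducible = H i , F i , red
      a* = collapsedVertex {G i} {H i} {F i} red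

      tuple : Fin (suc m) → Vec (Fin N) R
      tuple j = Vec.insertAt core (f a*) (petal j)

      tip : Fin (suc m) → Fin N
      tip j = Vec.lookup (tuple j) (f a*)

      ι : Fin (rF i) → Fin (suc m)
      ι j = inject≤ j (rF≤M i reducible)

      f-inj : Injective _≡_ _≡_ f
      f-inj eq = proj₁ (copies zero) (cong (Vec.lookup (tuple zero)) eq)

      tip-inj : Injective _≡_ _≡_ tip
      tip-inj {j} {j′} eq = petal-inj
        (trans (sym (insertAt-lookup core (f a*) (petal j))) (trans eq (insertAt-lookup core (f a*) (petal j′))))

      ι-inj : Injective _≡_ _≡_ ι
      ι-inj {j} {j′} = inject≤-injective (rF≤M i reducible) (rF≤M i reducible) j j′

      agree : ∀ j j′ {b} → b ≢ a* → Vec.lookup (tuple j) (f b) ≡ Vec.lookup (tuple j′) (f b)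
      agree j j′ b≢a* =
        trans (lookup-insertAt-≢ core fa*≢fb (petal j)) (sym (lookup-insertAt-≢ core fa*≢fb (petal j′)))
        where fa*≢fb = λ eq → b≢a* (f-inj (sym eq))

      conclude : MonoCopy (restrict c (tip ∘ ι)) i (F i) ⊎ ∃[ j ] MonoCopy (restrict c (tip ∘ ι)) j (G j) →
                 ∃[ j ] MonoCopy c j (G j)
      conclude (inj₁ F-copy) =
        i , glue {c = c} {i} {G i} {H i} {F i} c-sym red (λ j → Vec.lookup (tuple j) ∘ f) copies agree tip-inj
                 (MonoCopy-lift {c = restrict c tip} {i} {F i} ι-inj F-copy)
      conclude (inj₂ (j , G-copy)) = j , MonoCopy-lift {c = c} {j} {G j} (ι-inj ∘ tip-inj) G-copy

    from-sunflower : Sunflower _≟-label_ label centre m → ∃[ j ] MonoCopy c j (G j)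
    from-sunflower record { kind = i , w ; core = core ; petal = petal ; petal-injective = petal-inj
                          ; tuple-distinct = distinct ; tuple-label = labelled } =
      from-petals (reduction i) petal-inj λ j →
        IsMonoCopy-lift {c = c} {i} {H i} (λ {a} {b} → Distinct-lookup-injective (distinct j) a b)
                        (labelOf-copy (restrict c (Vec.lookup (tuple j))) (found (tuple j)) (labelled j))
      where
      tuple : Fin (suc m) → Vec (Fin N) R
      tuple j = Vec.insertAt core (centre (i , w)) (petal j)

  arrows : ∀ {N} → length labels * m < N ∸ R′ → Arrows q N G
  arrows few-labels c c-sym =
    from-sunflower c c-sym (sunflower _≟-label_ (label c c-sym) centre labels (λ _ → ∈-labels _) few-labels)

k<m⇒m*n<m*[1+n]∸k : ∀ {k m} n → k < m → m * n < m * suc n ∸ k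
k<m⇒m*n<m*[1+n]∸k {k} {m} n k<m = m+n≤o⇒m≤o∸n (suc (m * n)) (begin
  suc (m * n + k)   ≡⟨ +-suc (m * n) k ⟨
  m * n + suc k     ≤⟨ +-monoʳ-≤ (m * n) k<m ⟩
  m * n + m         ≡⟨ +-comm (m * n) m ⟩
  m + m * n         ≡⟨ *-suc m n ⟨
  m * suc n         ∎)
  where open ≤-Reasoning

lemma2p1 : (q : ℕ) → 1 ≤ q → (G H F : Fin q → Graph3) →
    (∀ i → ReducibleTo (G i) (H i) (F i) ⊎ (¬ Reducible (G i) × H i ≡ G i)) →
    (rG rH : ℕ) (rF : Fin q → ℕ) →
    IsRamsey q rG G → IsRamsey q rH H →
    (∀ i → Reducible (G i) → IsRamsey q (rF i) (replace G i (F i))) →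
    (M : ℕ) → 1 ≤ M → (∀ i → Reducible (G i) → rF i ≤ M) →
    (M ≡ 1 ⊎ ∃[ i ] (Reducible (G i) × M ≡ rF i)) →
    rG ≤ rH ^ maxFin (λ i → v (H i)) * q * M
lemma2p1 (suc q) _ G H F reduction rG (suc R′) rF G-ramsey H-ramsey F-ramsey (suc m) _ rF≤M _ =
  ramsey-minimal {Gs = G} G-ramsey 1≤N (arrows few-labels)
  where
  open Reduction G H F reduction (proj₁ (proj₂ H-ramsey)) rF F-ramsey rF≤M
  R≤X : suc R′ ≤ suc R′ ^ h * suc q
  R≤X = ramsey-≤-power {Hs = H} h (≤-maxFin (λ i → v (H i))) H-ramsey
  few-labels : length labels * m < suc R′ ^ h * suc q * suc m ∸ R′
  few-labels = ≤-<-trans (*-monoˡ-≤ m length-labels) (k<m⇒m*n<m*[1+n]∸k m R≤X)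
  1≤N : 1 ≤ suc R′ ^ h * suc q * suc m
  1≤N = ≤-trans (≤-trans (s≤s z≤n) R≤X) (m≤m*n _ (suc m))
lemma2p1 zero    () _ _ _ _ _ _        _ _ _        _ _ _    _  _
lemma2p1 (suc q) _  _ _ _ _ _ zero     _ _ (() , _) _ _ _    _  _
lemma2p1 (suc q) _  _ _ _ _ _ (suc R′) _ _ _        _ zero () _  _
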